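{- For every binary string $S$, $Mdim(S)=SWdim(S)$.
   Context: For a finite binary string $s$ (indexed from $0$), let $n(s)=\{i: s_i=1\}\subseteq\mathbb{N}$. For a binary string $S$ and $w\in\mathbb{N}$, $\mathfrak{S}_w=\{n(s): s \text{ a substring of } S \text{ of length } w\}$; the VC dimension of a family $\mathcal{C}$ of subsets of $\mathbb{N}$ is the largest size of a set $B$ with $\{c\cap B: c\in\mathcal{C}\}$ equal to the power set of $B$; $SWdim(S)=\max\{VCdim(\mathfrak{S}_w): w\in\mathbb{N}\}$ ($\infty$ if no maximum). A $d$-mask on $S$ is, for fixed distinct indices $i_0<i_1<\dots<i_{d-1}$, the set $\{\langle S_{i_0+t},\dots,S_{i_{d-1}+t}\rangle : t\}$ where $t$ ranges over all values for which all these indices lie in the index set of $S$. It is full if it contains all $2^d$ binary sequences of length $d$. $Mdim(S)=\max\{d: S \text{ has a full } d\text{ -mask}\}$ ($\infty$ if no maximum). -}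

module Defs where

open import Data.Bool using (Bool; true; false; _∧_)
open import Data.Nat using (ℕ; _<_; _≤_; _+_; _<ᵇ_)
open import Data.Integer using (ℤ; +_) renaming (_+_ to _+ℤ_)
open import Data.Fin using (Fin) renaming (_<_ to _<F_)
open import Data.Maybe using (Maybe; just; nothing)
open import Data.Unit using (⊤)
open import Data.Product using (Σ; _×_; ∃; ∃-syntax)
open import Relation.Binary.PropositionalEquality using (_≡_)
open import Relation.Nullary using (¬_)
open import Function.Definitions using (Injective)
open import Function.Bundles using (_⇔_)

-- A binary string indexed from 0: either finite (len = just n, index set {0,…,n-1})
-- or infinite (len = nothing, index set ℕ).  Values of 'bits' outside the index
-- set are irrelevant (never consulted by the definitions below).
record BinString : Set where
  constructor mkString
  field
    len  : Maybe ℕ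
    bits : ℕ → Bool
open BinString public

InS : BinString → ℕ → Set
InS S i with len S
... | just n  = i < n
... | nothing = ⊤

ValidSub : BinString → ℕ → ℕ → Set
ValidSub S t w = ∀ j → j < w → InS S (t + j)

-- membership of j in n(s), where s is the substring of S of length w starting at t
-- (s is indexed from 0, so j ∈ n(s) iff j < w and s_j = S_{t+j} = 1)
memb : BinString → ℕ → ℕ → ℕ → Bool
memb S t w j = (j <ᵇ w) ∧ bits S (t + j)

-- 𝔖_w shatters the d-element set B = {B 0, …, B (d-1)} ⊆ ℕ:
-- every subset of B (given by its characteristic function σ) is c ∩ B for some c ∈ 𝔖_w.
ShattersSW : BinString → ℕ → (d : ℕ) → (Fin d → ℕ) → Set
ShattersSW S w d B =
  Injective _≡_ _≡_ B ×
  ((σ : Fin d → Bool) → ∃[ t ] (ValidSub S t w × (∀ k → memb S t w (B k) ≡ σ k)))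

data ℕ∞ : Set where
  fin : ℕ → ℕ∞
  ∞   : ℕ∞

IsMax : (ℕ → Set) → ℕ → Set
IsMax P m = P m × (∀ d → P d → d ≤ m)

-- "max {d : P d} = v", with value ∞ when there is no maximum
MaxIs : (ℕ → Set) → ℕ∞ → Set
MaxIs P (fin m) = IsMax P m
MaxIs P ∞       = ¬ (∃[ m ] IsMax P m)

IsVCdimSW : BinString → ℕ → ℕ → Set
IsVCdimSW S w m = IsMax (λ d → ∃[ B ] ShattersSW S w d B) m

SWdimIs : BinString → ℕ∞ → Set
SWdimIs S v = MaxIs (λ m → ∃[ w ] IsVCdimSW S w m) v

BitAt : BinString → ℤ → Bool → Set
BitAt S p b = ∃[ n ] ((p ≡ + n) × InS S n × (bits S n ≡ b))

-- the d-mask with indices i_0 < … < i_{d-1} is full: every σ ∈ {0,1}^d equals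
-- ⟨S_{i_0+t}, …, S_{i_{d-1}+t}⟩ for some shift t ∈ ℤ with all indices in range
FullMask : BinString → (d : ℕ) → (Fin d → ℕ) → Set
FullMask S d i =
  (∀ j k → j <F k → i j < i k) ×
  ((σ : Fin d → Bool) → ∃[ t ] (∀ k → BitAt S (+ (i k) +ℤ t) (σ k)))

HasFullMask : BinString → ℕ → Set
HasFullMask S d = ∃[ i ] FullMask S d i

MdimIs : BinString → ℕ∞ → Set
MdimIs S v = MaxIs (HasFullMask S) v

-- A full d-mask with indices i₀ < … < i_{d-1} and the window of width
-- i_{d-1} - i₀ + 1 starting at the occurrence of i₀ shatter the same d-set
-- {i_k - i₀}; conversely, listing a shattered set B in increasing order gives
-- the indices of a full mask, the window start serving as the shift.  Hence
-- "S has a full d-mask" and "some 𝔖_w shatters a d-set" coincide.  Since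
-- 𝔖_w only shatters subsets of {0,…,w-1}, each VCdim(𝔖_w) exists, and the
-- maximum over d of the first predicate is the maximum over w of these
-- VC dimensions.
module Submission where

open import Defs
open import Function.Bundles using (_⇔_; mk⇔; Equivalence)
open import Function.Definitions using (Injective)
open import Function.Construct.Composition using (_⇔-∘_)
open import Data.Bool using (true; _∧_)
open import Data.Bool.Properties using (T-≡; T-∧)
open import Data.Nat using (ℕ; zero; suc; _+_; _∸_; _≤_; _<_; z≤n; s≤s; s≤s⁻¹; _≤?_)
import Data.Nat.Properties as ℕ
open import Data.Integer using (+_) renaming (_+_ to _+ℤ_)
import Data.Integer.Properties as ℤ
open import Data.Fin using (Fin; fromℕ; fromℕ<; toℕ) renaming (_<_ to _<F_; _≤_ to _≤F_; zero to fzero; suc to fsuc)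
import Data.Fin.Properties as Fin
open import Data.Maybe using (just; nothing)
open import Data.Unit using (tt)
open import Data.Empty using (⊥-elim)
open import Data.Sum using (inj₁; inj₂)
open import Data.Product using (_×_; _,_; proj₁; proj₂; ∃; ∃-syntax)
open import Relation.Binary.PropositionalEquality
open import Relation.Binary.Definitions using (tri<; tri≈; tri>)
open import Relation.Nullary using (¬_)
open import Relation.Nullary.Negation using (¬¬-map)
open import Relation.Nullary.Decidable using (decidable-stable)
open import Data.List using (List; length; lookup; tabulate)
open import Data.List.Properties using (length-tabulate)
import Data.List.Relation.Unary.All as All
open import Data.List.Relation.Unary.AllPairs as AllPairs using (AllPairs; _∷_)
open import Data.List.Relation.Unary.Any using (index)
open import Data.List.Relation.Unary.Any.Properties using (lookup-index)
open import Data.List.Membership.Propositional using (_∈_)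
open import Data.List.Membership.Propositional.Properties using (∈-tabulate⁺; ∈-tabulate⁻; ∈-lookup)
open import Data.List.Relation.Binary.Permutation.Propositional using (↭-sym; ↭⇒↭ₛ)
open import Data.List.Relation.Binary.Permutation.Propositional.Properties using (∈-resp-↭; ↭-length)
open import Data.List.Relation.Binary.Permutation.Setoid.Properties (setoid ℕ) using (Unique-resp-↭)
import Data.List.Relation.Unary.Unique.Propositional.Properties as Unique
open import Data.List.Relation.Unary.Sorted.TotalOrder.Properties using (Sorted⇒AllPairs)
open import Data.List.Sort ℕ.≤-decTotalOrder using (sort; sort-↭; sort-↗)

open Equivalence using (to; from)

isMax-resp : ∀ {P Q : ℕ → Set} → (∀ d → P d ⇔ Q d) → ∀ m → IsMax P m ⇔ IsMax Q m
isMax-resp P⇔Q m =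
  mk⇔ (λ (pm , maximal) → to (P⇔Q m) pm , λ d qd → maximal d (from (P⇔Q d) qd))
      (λ (qm , maximal) → from (P⇔Q m) qm , λ d pd → maximal d (to (P⇔Q d) pd))

maxIs-resp : ∀ {P Q : ℕ → Set} → (∀ m → IsMax P m ⇔ IsMax Q m) → ∀ v → MaxIs P v ⇔ MaxIs Q v
maxIs-resp P⇔Q (fin m) = P⇔Q m
maxIs-resp P⇔Q ∞ =
  mk⇔ (λ ¬maxP (m , maxQ) → ¬maxP (m , from (P⇔Q m) maxQ))
      (λ ¬maxQ (m , maxP) → ¬maxQ (m , to (P⇔Q m) maxP))

¬¬-isMax : ∀ {P : ℕ → Set} b {d} → P d → (∀ e → P e → e ≤ b) → ¬ ¬ (∃[ m ] IsMax P m)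
¬¬-isMax zero    {d} pd ≤b ¬max = ¬max (d , pd , λ e pe → ℕ.≤-trans (≤b e pe) z≤n)
¬¬-isMax {P} (suc b) pd ≤1+b ¬max = ¬¬-isMax b pd ≤b ¬max
  where
  ≤b : ∀ e → P e → e ≤ b
  ≤b e pe with ℕ.m≤n⇒m<n∨m≡n (≤1+b e pe)
  ... | inj₁ e<1+b = s≤s⁻¹ e<1+b
  ... | inj₂ refl  = ⊥-elim (¬max (suc b , pe , ≤1+b))

module _ (R : ℕ → ℕ → Set) (bounded : ∀ w → ∃[ b ] (∀ d → R w d → d ≤ b)) where

  isMax-⋃⇔isMax-maxima : ∀ M → IsMax (λ d → ∃[ w ] R w d) M ⇔ IsMax (λ m → ∃[ w ] IsMax (R w) m) M
  isMax-⋃⇔isMax-maxima M = mk⇔ ⋃⇒maxima maxima⇒⋃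
    where
    ⋃⇒maxima : IsMax (λ d → ∃[ w ] R w d) M → IsMax (λ m → ∃[ w ] IsMax (R w) m) M
    ⋃⇒maxima ((w , rM) , maximal) =
      (w , rM , λ d rd → maximal d (w , rd)) , λ m (w′ , rm , _) → maximal m (w′ , rm)

    maxima⇒⋃ : IsMax (λ m → ∃[ w ] IsMax (R w) m) M → IsMax (λ d → ∃[ w ] R w d) M
    maxima⇒⋃ ((w , rM , _) , maximal) = (w , rM) , ≤M
      where
      -- The maximum of R w′ exists only up to double negation, but d ≤ M is decidable.
      ≤M : ∀ d → ∃[ w ] R w d → d ≤ M
      ≤M d (w′ , rd) = decidable-stable (d ≤? M)
        (¬¬-map (λ (m , isMax) → ℕ.≤-trans (proj₂ isMax d rd) (maximal m (w′ , isMax)))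
                (¬¬-isMax (proj₁ (bounded w′)) rd (proj₂ (bounded w′))))

  maxIs-⋃⇔maxIs-maxima : ∀ v → MaxIs (λ d → ∃[ w ] R w d) v ⇔ MaxIs (λ m → ∃[ w ] IsMax (R w) m) v
  maxIs-⋃⇔maxIs-maxima = maxIs-resp isMax-⋃⇔isMax-maxima

Increasing : ∀ {n} → (Fin n → ℕ) → Set
Increasing i = ∀ j k → j <F k → i j < i k

increasing⇒injective : ∀ {n} {i : Fin n → ℕ} → Increasing i → Injective _≡_ _≡_ i
increasing⇒injective increasing {j} {k} ij≡ik with Fin.<-cmp j k
... | tri< j<k _ _ = ⊥-elim (ℕ.<-irrefl ij≡ik (increasing j k j<k))
... | tri≈ _ j≡k _ = j≡k
... | tri> _ _ k<j = ⊥-elim (ℕ.<-irrefl (sym ij≡ik) (increasing k j k<j))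

increasing⇒monotone : ∀ {n} {i : Fin n → ℕ} → Increasing i → ∀ {j k} → j ≤F k → i j ≤ i k
increasing⇒monotone increasing {j} {k} j≤k with ℕ.m≤n⇒m<n∨m≡n j≤k
... | inj₁ j<k = ℕ.<⇒≤ (increasing j k j<k)
... | inj₂ j≡k = ℕ.≤-reflexive (cong _ (Fin.toℕ-injective j≡k))

AllPairs-lookup : ∀ {R : ℕ → ℕ → Set} {xs : List ℕ} → AllPairs R xs →
                  ∀ i j → i <F j → R (lookup xs i) (lookup xs j)
AllPairs-lookup (Rx ∷ _)   fzero    (fsuc j) _         = All.lookup Rx (∈-lookup j)
AllPairs-lookup (_ ∷ Rxs) (fsuc i) (fsuc j) (s≤s i<j) = AllPairs-lookup Rxs i j i<j

increasing-enumeration : ∀ {d} {B : Fin d → ℕ} → Injective _≡_ _≡_ B →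
  ∃[ i ] (Increasing i × (∀ k → ∃[ k′ ] i k ≡ B k′) × (∀ k′ → ∃[ k ] i k ≡ B k′))
increasing-enumeration {d} {B} B-injective =
  subst Enumeration length-sorted (lookup sorted , increasing , sorted⊆B , B⊆sorted)
  where
  Enumeration : ℕ → Set
  Enumeration n = ∃ λ (i : Fin n → ℕ) →
    Increasing i × (∀ k → ∃[ k′ ] i k ≡ B k′) × (∀ k′ → ∃[ k ] i k ≡ B k′)

  values sorted : List ℕ
  values = tabulate B
  sorted = sort values

  length-sorted : length sorted ≡ d
  length-sorted = trans (↭-length (sort-↭ values)) (length-tabulate B)

  increasing : Increasing (lookup sorted)
  increasing = AllPairs-lookup (AllPairs.zipWith (λ (x≤y , x≢y) → ℕ.≤∧≢⇒< x≤y x≢y)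
    ( Sorted⇒AllPairs ℕ.≤-totalOrder (sort-↗ values)
    , Unique-resp-↭ (↭⇒↭ₛ (↭-sym (sort-↭ values))) (Unique.tabulate⁺ B-injective)))

  sorted⊆B : ∀ k → ∃[ k′ ] lookup sorted k ≡ B k′
  sorted⊆B k = ∈-tabulate⁻ (∈-resp-↭ (sort-↭ values) (∈-lookup k))

  B⊆sorted : ∀ k′ → ∃[ k ] lookup sorted k ≡ B k′
  B⊆sorted k′ = index B∈ , sym (lookup-index B∈)
    where
    B∈ : B k′ ∈ sorted
    B∈ = ∈-resp-↭ (↭-sym (sort-↭ values)) (∈-tabulate⁺ k′)

InS-≤ : ∀ S {m n} → m ≤ n → InS S n → InS S m
InS-≤ (mkString (just _) _) m≤n n<len = ℕ.≤-<-trans m≤n n<len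
InS-≤ (mkString nothing  _) _   _     = tt

memb-< : ∀ S {t w j} → j < w → memb S t w j ≡ bits S (t + j)
memb-< S {t} {j = j} j<w = cong (_∧ bits S (t + j)) (to T-≡ (ℕ.<⇒<ᵇ j<w))

memb≡true⇒< : ∀ S {t w j} → memb S t w j ≡ true → j < w
memb≡true⇒< S {w = w} {j} memb≡true = ℕ.<ᵇ⇒< j w (proj₁ (to T-∧ (from T-≡ memb≡true)))

shatters⇒< : ∀ S {w d B} → ShattersSW S w d B → ∀ k → B k < w
shatters⇒< S (_ , shatter) k = memb≡true⇒< S (proj₂ (proj₂ (shatter (λ _ → true))) k)

shatters⇒≤width : ∀ S {w d B} → ShattersSW S w d B → d ≤ w
shatters⇒≤width S {w} {B = B} sh@(B-injective , _) = Fin.injective⇒≤ {f = λ k → fromℕ< (B<w k)}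
  λ {j} {k} e → B-injective (begin
    B j                  ≡⟨ Fin.toℕ-fromℕ< (B<w j) ⟨
    toℕ (fromℕ< (B<w j)) ≡⟨ cong toℕ e ⟩
    toℕ (fromℕ< (B<w k)) ≡⟨ Fin.toℕ-fromℕ< (B<w k) ⟩
    B k                  ∎)
  where
  open ≡-Reasoning
  B<w : ∀ k → B k < w
  B<w = shatters⇒< S sh

+-shift : ∀ {a c n} t → a ≤ c → + a +ℤ t ≡ + n → + c +ℤ t ≡ + (n + (c ∸ a))
+-shift {a} {c} {n} t a≤c start = begin
  + c +ℤ t                  ≡⟨ cong (λ x → + x +ℤ t) (ℕ.m∸n+n≡m a≤c) ⟨
  + (c ∸ a + a) +ℤ t        ≡⟨ cong (_+ℤ t) (ℤ.pos-+ (c ∸ a) a) ⟩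
  + (c ∸ a) +ℤ + a +ℤ t     ≡⟨ ℤ.+-assoc (+ (c ∸ a)) (+ a) t ⟩
  + (c ∸ a) +ℤ (+ a +ℤ t)   ≡⟨ cong (+ (c ∸ a) +ℤ_) start ⟩
  + (c ∸ a + n)             ≡⟨ cong +_ (ℕ.+-comm (c ∸ a) n) ⟩
  + (n + (c ∸ a))           ∎
  where open ≡-Reasoning

bitAt-shift : ∀ {S a c n b} t → a ≤ c → + a +ℤ t ≡ + n → BitAt S (+ c +ℤ t) b →
              InS S (n + (c ∸ a)) × bits S (n + (c ∸ a)) ≡ b
bitAt-shift t a≤c start (m , c+t≡m , m∈S , bit≡b)
  rewrite ℤ.+-injective (trans (sym c+t≡m) (+-shift t a≤c start)) = m∈S , bit≡b

ShatteredBy : BinString → ℕ → ℕ → Set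
ShatteredBy S w d = ∃[ B ] ShattersSW S w d B

fullMask⇒shatters : ∀ {S d i} → FullMask S (suc d) i →
  ShattersSW S (suc (i (fromℕ d) ∸ i fzero)) (suc d) (λ k → i k ∸ i fzero)
fullMask⇒shatters {S} {d} {i} (increasing , full) =
  increasing⇒injective (λ j k j<k → ℕ.∸-monoˡ-< (increasing j k j<k) (first≤ j)) , shatter
  where
  w : ℕ
  w = suc (i (fromℕ d) ∸ i fzero)

  B : Fin (suc d) → ℕ
  B k = i k ∸ i fzero

  first≤ : ∀ k → i fzero ≤ i k
  first≤ k = increasing⇒monotone increasing {fzero} {k} z≤n

  B<w : ∀ k → B k < w
  B<w k = s≤s (ℕ.∸-monoˡ-≤ (i fzero) (increasing⇒monotone increasing (Fin.≤fromℕ k)))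

  shatter : ∀ σ → ∃[ t ] (ValidSub S t w × (∀ k → memb S t w (B k) ≡ σ k))
  shatter σ with full σ
  ... | t , bit with bit fzero
  ... | n , start , _ , _ = n , valid , membership
    where
    occurrence : ∀ k → InS S (n + B k) × bits S (n + B k) ≡ σ k
    occurrence k = bitAt-shift t (first≤ k) start (bit k)

    valid : ValidSub S n w
    valid j (s≤s j≤last) = InS-≤ S (ℕ.+-monoʳ-≤ n j≤last) (proj₁ (occurrence (fromℕ d)))

    membership : ∀ k → memb S n w (B k) ≡ σ k
    membership k = trans (memb-< S (B<w k)) (proj₂ (occurrence k))

shatters⇒fullMask : ∀ {S w d B i} → ShattersSW S w d B → Increasing i →
  (∀ k → ∃[ k′ ] i k ≡ B k′) → (∀ k′ → ∃[ k ] i k ≡ B k′) → FullMask S d i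
shatters⇒fullMask {S} {w} {d} {B} {i} sh@(_ , shatter) increasing i⊆B B⊆i = increasing , full
  where
  full : ∀ σ → ∃[ t ] (∀ k → BitAt S (+ i k +ℤ t) (σ k))
  full σ with shatter (λ k′ → σ (proj₁ (B⊆i k′)))
  ... | s , valid , membership = + s , bitAt
    where
    bitAt : ∀ k → BitAt S (+ i k +ℤ + s) (σ k)
    bitAt k with i⊆B k
    ... | k′ , ik≡Bk′ = s + B k′ , cong +_ position , valid (B k′) (shatters⇒< S sh k′) , bit
      where
      open ≡-Reasoning
      position : i k + s ≡ s + B k′
      position = trans (cong (_+ s) ik≡Bk′) (ℕ.+-comm (B k′) s)

      bit : bits S (s + B k′) ≡ σ k
      bit = begin
        bits S (s + B k′)          ≡⟨ memb-< S (shatters⇒< S sh k′) ⟨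
        memb S s w (B k′)          ≡⟨ membership k′ ⟩
        σ (proj₁ (B⊆i k′))         ≡⟨ cong σ (increasing⇒injective increasing
                                        (trans (proj₂ (B⊆i k′)) (sym ik≡Bk′))) ⟩
        σ k                        ∎

hasFullMask⇒shattered : ∀ S d → HasFullMask S d → ∃[ w ] ShatteredBy S w d
hasFullMask⇒shattered S zero    _          = 0 , (λ ()) , (λ { {()} }) , λ _ → 0 , (λ _ ()) , λ ()
hasFullMask⇒shattered S (suc d) (i , mask) = _ , _ , fullMask⇒shatters mask

shattered⇒hasFullMask : ∀ S d → ∃[ w ] ShatteredBy S w d → HasFullMask S d
shattered⇒hasFullMask S d (w , B , sh) with increasing-enumeration (proj₁ sh)
... | i , increasing , i⊆B , B⊆i = i , shatters⇒fullMask sh increasing i⊆B B⊆i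

hasFullMask⇔shattered : ∀ S d → HasFullMask S d ⇔ (∃[ w ] ShatteredBy S w d)
hasFullMask⇔shattered S d = mk⇔ (hasFullMask⇒shattered S d) (shattered⇒hasFullMask S d)

proposition3 : (S : BinString) (v : ℕ∞) → MdimIs S v ⇔ SWdimIs S v
proposition3 S v =
  maxIs-⋃⇔maxIs-maxima (ShatteredBy S)
                       (λ w → w , λ d (B , sh) → shatters⇒≤width S sh) v
  ⇔-∘ maxIs-resp (isMax-resp (hasFullMask⇔shattered S)) v
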